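{- Let $k\ge1$ be an integer and $\sigma,\tau\in\mathfrak S_n$. Then $\mathrm{RC}_k(\sigma)=\mathrm{RC}_k(\tau)$ if and only if one can go from $\sigma$ to $\tau$ by a finite sequence of moves, each move exchanging two letters in consecutive positions whose values differ by at least $k$.
   Context: For $\pi\in\mathfrak S_n$, extend $\pi$ to a bijection of $\mathbb Z$ by $\pi(j)=j$ for $j\notin[1,n]$. The $k$-descent code is $\mathrm{DC}_k(\pi)=d_1\cdots d_n$ with $d_i=1+\#\{j: i-k+1\le j\le i-1,\ \pi(j)<\pi(i)\}$ (the rank of $\pi(i)$ among $\pi(i),\pi(i-1),\dots,\pi(i-k+1)$). The $k$-recoil code is $\mathrm{RC}_k(\pi)=\mathrm{DC}_k(\pi^{ -1})$. Equivalently, $\mathrm{RC}_k(\sigma)=\mathrm{RC}_k(\tau)$ iff for every $i\le n-k+1$ the subword of $\sigma$ formed by the letters with values in $[i,i+k-1]$ has the same standardization as the corresponding subword of $\tau$. -}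

module Defs where

open import Data.Nat as ℕ using (ℕ; zero; suc; _≤_; ∣_-_∣)
open import Data.Integer as ℤ using (ℤ; +_; _-_; _<?_)
open import Data.Fin using (Fin; toℕ; fromℕ<)
open import Data.Fin.Permutation using (Permutation′; _⟨$⟩ʳ_; flip; transpose; _≈_)
open import Data.List using (List; map; filter; length; upTo)
open import Data.Vec using (Vec; tabulate)
open import Data.Product using (Σ; ∃; _×_)
open import Data.Bool using (if_then_else_)
open import Relation.Nullary using (yes; no)
open import Relation.Binary.PropositionalEquality using (_≡_)
open import Relation.Binary.Construct.Closure.ReflexiveTransitive using (Star)

-- Extension of a permutation π of [1,n] (positions and values 1-based) to a
-- bijection of ℤ, being the identity outside [1,n].
ext : ∀ {n} → Permutation′ n → ℤ → ℤ
ext {n} π (+ suc m) with m ℕ.<? n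
... | yes m<n = + suc (toℕ (π ⟨$⟩ʳ fromℕ< m<n))
... | no _ = + suc m
ext π j = j

-- d_i = 1 + #{ j : i-k+1 ≤ j ≤ i-1, π(j) < π(i) }, j ranging over ℤ,
-- enumerated as j = i - t with t = 1, …, k-1.
dcEntry : ∀ {n} → ℕ → Permutation′ n → ℤ → ℕ
dcEntry k π i =
  suc (length (filter (λ t → ext π (i - + t) <? ext π i)
                      (map suc (upTo (k ℕ.∸ 1)))))

-- k-descent code DC_k(π) = d_1 ⋯ d_n  (entry at Fin index p is d_{p+1})
DC : ∀ {n} → ℕ → Permutation′ n → Vec ℕ n
DC k π = tabulate (λ p → dcEntry k π (+ suc (toℕ p)))

RC : ∀ {n} → ℕ → Permutation′ n → Vec ℕ n
RC k π = DC k (flip π)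

Move : ∀ {n} → ℕ → Permutation′ n → Permutation′ n → Set
Move {n} k σ τ =
  Σ (Fin n) λ i → Σ (Fin n) λ i' →
    (toℕ i' ≡ suc (toℕ i)) ×
    (k ≤ ∣ toℕ (σ ⟨$⟩ʳ i) - toℕ (σ ⟨$⟩ʳ i') ∣) ×
    (∀ p → τ ⟨$⟩ʳ p ≡ σ ⟨$⟩ʳ (transpose i i' ⟨$⟩ʳ p))

Reachable : ∀ {n} → ℕ → Permutation′ n → Permutation′ n → Set
Reachable k σ τ = ∃ λ ρ → Star (Move k) σ ρ × (ρ ≈ τ)

-- Both conditions say that any two letters whose values differ by less than k
-- occur in the same relative order in σ and τ.  A move exchanges two adjacent
-- letters that are far apart, so it keeps the order of every close pair.  The
-- recoil code determines that order: entry v counts the letters among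
-- v-1, …, v-k+1 standing to the left of v, so, by induction on the larger
-- letter, the first close pair (u, v) ordered differently in σ and τ would make
-- these counts at v differ.  Conversely, if close pairs are ordered alike, σ is
-- sorted into τ one letter at a time, moving τ's next letter leftwards; every
-- letter it passes stands after it in τ but before it in σ, so it is far from it.
module Submission where

open import Defs
open import Data.Nat using (ℕ; _≤_)
open import Data.Fin.Permutation using (Permutation′)
open import Relation.Binary.PropositionalEquality using (_≡_)
open import Data.Product using (_×_)

open import Level using (Level)
open import Data.Nat as ℕ using (zero; suc; _<_; _+_; _∸_; ∣_-_∣; z≤n; s≤s; z<s; s<s; s≤s⁻¹; s<s⁻¹)
open import Data.Nat.Properties
open import Data.Integer as ℤ using (ℤ; +_; -[1+_]; _-_; +<+; +≤+)
import Data.Integer.Properties as ℤ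
open import Data.Fin as Fin using (Fin; toℕ; fromℕ<)
open import Data.Fin.Properties using (toℕ-injective; toℕ<n; toℕ-fromℕ<; fromℕ<-toℕ)
open import Data.Fin.Permutation using (_⟨$⟩ʳ_; _⟨$⟩ˡ_; flip; transpose; _≈_; _∘ₚ_; inverseˡ; inverseʳ)
import Data.Fin.Permutation.Components as PC
open import Data.List using (List; []; _∷_; map; filter; length; upTo)
open import Data.List.Membership.Propositional using (_∈_; lose)
open import Data.List.Membership.Propositional.Properties using (∈-map⁺; ∈-map⁻; ∈-upTo⁺; ∈-upTo⁻)
open import Data.List.Relation.Unary.All as All using (All; []; _∷_)
open import Data.List.Relation.Unary.Any using (Any; here; there)
open import Data.Vec using (lookup)
open import Data.Vec.Properties using (lookup∘tabulate; tabulate-cong)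
open import Data.Product using (∃; _,_; proj₁; proj₂)
open import Data.Sum using (inj₁; inj₂)
open import Data.Empty using (⊥-elim)
open import Function using (id; _∘_; _⇔_; mk⇔; Equivalence; Injective)
open import Function.Properties.Inverse using (Inverse⇒Injection)
open import Function.Bundles using (Injection)
open import Relation.Nullary using (¬_; Dec; yes; no; contradiction)
open import Relation.Unary using (Pred; Decidable)
open import Relation.Binary.Definitions using (Symmetric; tri<; tri≈; tri>)
open import Relation.Binary.PropositionalEquality using (_≢_; refl; sym; trans; cong; subst; subst₂; module ≡-Reasoning)
open import Relation.Binary.Construct.Closure.ReflexiveTransitive using (Star; ε; _◅_; _◅◅_)

module _ {a p q : Level} {A : Set a} {P : Pred A p} {Q : Pred A q} (P? : Decidable P) (Q? : Decidable Q) where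

  length-filter-mono : ∀ {xs} → All (λ x → P x → Q x) xs → length (filter P? xs) ≤ length (filter Q? xs)
  length-filter-mono {[]} [] = z≤n
  length-filter-mono {x ∷ xs} (P⇒Q ∷ rest) with P? x | Q? x
  ... | yes _  | yes _  = s≤s (length-filter-mono rest)
  ... | yes px | no ¬qx = contradiction (P⇒Q px) ¬qx
  ... | no _   | yes _  = m≤n⇒m≤1+n (length-filter-mono rest)
  ... | no _   | no _   = length-filter-mono rest

  length-filter-mono-< : ∀ {xs} → All (λ x → P x → Q x) xs → Any (λ x → Q x × ¬ P x) xs →
                         length (filter P? xs) < length (filter Q? xs)
  length-filter-mono-< {x ∷ xs} (_ ∷ rest) (here (qx , ¬px)) with P? x | Q? x
  ... | yes px | _      = contradiction px ¬px
  ... | no _   | yes _  = s≤s (length-filter-mono rest)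
  ... | no _   | no ¬qx = contradiction qx ¬qx
  length-filter-mono-< {x ∷ xs} (P⇒Q ∷ rest) (there witness) with P? x | Q? x
  ... | yes _  | yes _  = s≤s (length-filter-mono-< rest witness)
  ... | yes px | no ¬qx = contradiction (P⇒Q px) ¬qx
  ... | no _   | yes _  = m≤n⇒m≤1+n (length-filter-mono-< rest witness)
  ... | no _   | no _   = length-filter-mono-< rest witness

ext-nonpositive : ∀ {n} (π : Permutation′ n) {x : ℤ} → x ℤ.≤ + 0 → ext π x ≡ x
ext-nonpositive π {+ zero} _ = refl
ext-nonpositive π {+ suc _} (+≤+ ())
ext-nonpositive π { -[1+ _ ]} _ = refl

ext-fin : ∀ {n} (π : Permutation′ n) (u : Fin n) → ext π (+ suc (toℕ u)) ≡ + suc (toℕ (π ⟨$⟩ʳ u))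
ext-fin {n} π u with toℕ u ℕ.<? n
... | yes u<n = cong (λ x → + suc (toℕ (π ⟨$⟩ʳ x))) (fromℕ<-toℕ u u<n)
... | no u≮n = contradiction (toℕ<n u) u≮n

+suc[m+n]-+n : ∀ m n → + suc (m + n) - + n ≡ + suc m
+suc[m+n]-+n m n = begin
  + suc (m + n) - + n   ≡⟨ ℤ.m-n≡m⊖n (suc m + n) n ⟩
  ℤ._⊖_ (suc m + n) n   ≡⟨ ℤ.⊖-≥ (m≤n+m n (suc m)) ⟩
  + (suc m + n ∸ n)     ≡⟨ cong +_ (m+n∸n≡m (suc m) n) ⟩
  + suc m               ∎
  where open ≡-Reasoning

offsets : ℕ → List ℕ
offsets k = map suc (upTo (k ∸ 1))

∈-offsets⁻ : ∀ {k t} → t ∈ offsets k → 0 < t × t < k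
∈-offsets⁻ {suc k} t∈ with ∈-map⁻ suc t∈
... | _ , s∈ , refl = z<s , s<s (∈-upTo⁻ s∈)

∈-offsets⁺ : ∀ {k t} → 0 < t → t < k → t ∈ offsets k
∈-offsets⁺ {suc k} {suc t} _ (s<s t<k) = ∈-map⁺ suc (∈-upTo⁺ t<k)

∣m-n∣≤∣m-o∣ : ∀ {m n o} → m ≤ n → n ≤ o → ∣ m - n ∣ ≤ ∣ m - o ∣
∣m-n∣≤∣m-o∣ {m} {n} {o} m≤n n≤o = begin
  ∣ m - n ∣  ≡⟨ m≤n⇒∣m-n∣≡n∸m m≤n ⟩
  n ∸ m      ≤⟨ ∸-monoˡ-≤ m n≤o ⟩
  o ∸ m      ≡⟨ m≤n⇒∣m-n∣≡n∸m (≤-trans m≤n n≤o) ⟨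
  ∣ m - o ∣  ∎
  where open ≤-Reasoning

module _ {n : ℕ} where

  ⟨$⟩ˡ-injective : (σ : Permutation′ n) → Injective _≡_ _≡_ (σ ⟨$⟩ˡ_)
  ⟨$⟩ˡ-injective σ = Injection.injective (Inverse⇒Injection (flip σ))

  ⟨$⟩ʳ-injective : (σ : Permutation′ n) → Injective _≡_ _≡_ (σ ⟨$⟩ʳ_)
  ⟨$⟩ʳ-injective σ = Injection.injective (Inverse⇒Injection σ)

  -- σ ⟨$⟩ʳ_ maps positions to letters, so pos σ u is the position of the letter u.
  pos : Permutation′ n → Fin n → ℕ
  pos σ u = toℕ (σ ⟨$⟩ˡ u)

  pos-injective : (σ : Permutation′ n) {u w : Fin n} → pos σ u ≡ pos σ w → u ≡ w
  pos-injective σ = ⟨$⟩ˡ-injective σ ∘ toℕ-injective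

  Before : Permutation′ n → Fin n → Fin n → Set
  Before σ u w = pos σ u < pos σ w

  reflects⇒preserves : {σ τ : Permutation′ n} {u w : Fin n} →
                       (Before τ w u → Before σ w u) → Before σ u w → Before τ u w
  reflects⇒preserves {σ} {τ} {u} {w} reflect σuw with <-cmp (pos τ u) (pos τ w)
  ... | tri< τuw _ _ = τuw
  ... | tri≈ _ τu≡τw _ = contradiction (subst (λ x → Before σ x w) (pos-injective τ τu≡τw) σuw) (<-irrefl refl)
  ... | tri> _ _ τwu = contradiction (reflect τwu) (<-asym σuw)

  OrderAgreesOn : (Fin n → Fin n → Set) → Permutation′ n → Permutation′ n → Set
  OrderAgreesOn R σ τ = ∀ u w → R u w → Before σ u w → Before τ u w

  module _ {R : Fin n → Fin n → Set} where

    agreesOn-sym : Symmetric R → {σ τ : Permutation′ n} → OrderAgreesOn R σ τ → OrderAgreesOn R τ σ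
    agreesOn-sym R-sym {σ} {τ} σ→τ u w r = reflects⇒preserves {τ} {σ} (σ→τ w u (R-sym r))

    agreesOn-trans : {σ ρ τ : Permutation′ n} → OrderAgreesOn R σ ρ → OrderAgreesOn R ρ τ → OrderAgreesOn R σ τ
    agreesOn-trans σ→ρ ρ→τ u w r = ρ→τ u w r ∘ σ→ρ u w r

    ≈⇒agreesOn : {ρ τ : Permutation′ n} → ρ ≈ τ → OrderAgreesOn R ρ τ
    ≈⇒agreesOn {ρ} {τ} ρ≈τ u w _ = subst₂ _<_ (cong toℕ (same u)) (cong toℕ (same w))
      where
      open ≡-Reasoning
      same : ∀ v → ρ ⟨$⟩ˡ v ≡ τ ⟨$⟩ˡ v
      same v = begin
        ρ ⟨$⟩ˡ v                    ≡⟨ inverseˡ τ ⟨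
        τ ⟨$⟩ˡ (τ ⟨$⟩ʳ (ρ ⟨$⟩ˡ v))  ≡⟨ cong (τ ⟨$⟩ˡ_) (ρ≈τ (ρ ⟨$⟩ˡ v)) ⟨
        τ ⟨$⟩ˡ (ρ ⟨$⟩ʳ (ρ ⟨$⟩ˡ v))  ≡⟨ cong (τ ⟨$⟩ˡ_) (inverseʳ ρ) ⟩
        τ ⟨$⟩ˡ v                    ∎

  record Close (k : ℕ) (u w : Fin n) : Set where
    constructor close
    field distance< : ∣ toℕ u - toℕ w ∣ < k

  close-sym : {k : ℕ} → Symmetric (Close k)
  close-sym {k} {u} {w} (close uw) = close (subst (_< k) (∣-∣-comm (toℕ u) (toℕ w)) uw)

  SameLocalOrder : ℕ → Permutation′ n → Permutation′ n → Set
  SameLocalOrder k = OrderAgreesOn (Close k)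

  transpose-matchˡ : (i j : Fin n) → PC.transpose i j i ≡ j
  transpose-matchˡ i j with i Fin.≟ i
  ... | yes _ = refl
  ... | no i≢i = contradiction refl i≢i

  transpose-matchʳ : (i j : Fin n) → PC.transpose i j j ≡ i
  transpose-matchʳ i j with j Fin.≟ i
  ... | yes j≡i = j≡i
  ... | no _ with j Fin.≟ j
  ...   | yes _ = refl
  ...   | no j≢j = contradiction refl j≢j

  transpose-mismatch : {i j x : Fin n} → x ≢ i → x ≢ j → PC.transpose i j x ≡ x
  transpose-mismatch {i} {j} {x} x≢i x≢j with x Fin.≟ i
  ... | yes x≡i = contradiction x≡i x≢i
  ... | no _ with x Fin.≟ j
  ...   | yes x≡j = contradiction x≡j x≢j
  ...   | no _ = refl

  module _ {i j : Fin n} (adjacent : toℕ j ≡ suc (toℕ i)) where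

    private
      i≤j : toℕ i ≤ toℕ j
      i≤j = subst (toℕ i ≤_) (sym adjacent) (n≤1+n (toℕ i))

    transpose-adjacent-≤ : {x : Fin n} → x ≢ i → toℕ (PC.transpose j i x) ≤ toℕ x
    transpose-adjacent-≤ {x} x≢i with x Fin.≟ j
    ... | yes refl = i≤j
    ... | no _ with x Fin.≟ i
    ...   | yes x≡i = contradiction x≡i x≢i
    ...   | no _ = ≤-refl

    transpose-adjacent-≥ : {x : Fin n} → x ≢ j → toℕ x ≤ toℕ (PC.transpose j i x)
    transpose-adjacent-≥ {x} x≢j with x Fin.≟ j
    ... | yes x≡j = contradiction x≡j x≢j
    ... | no _ with x Fin.≟ i
    ...   | yes refl = i≤j
    ...   | no _ = ≤-refl

    transpose-adjacent-< : {x y : Fin n} → toℕ x < toℕ y → ¬ (x ≡ i × y ≡ j) →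
                           toℕ (PC.transpose j i x) < toℕ (PC.transpose j i y)
    transpose-adjacent-< {x} {y} x<y not-ij = by-cases (x Fin.≟ i) (y Fin.≟ j)
      where
      open ≤-Reasoning
      by-cases : Dec (x ≡ i) → Dec (y ≡ j) → toℕ (PC.transpose j i x) < toℕ (PC.transpose j i y)
      by-cases (yes refl) (yes refl) = contradiction (refl , refl) not-ij
      by-cases (yes refl) (no y≢j) = begin-strict
        toℕ (PC.transpose j i i)  ≡⟨ cong toℕ (transpose-matchʳ j i) ⟩
        toℕ j                     <⟨ ≤∧≢⇒< (subst (_≤ toℕ y) (sym adjacent) x<y) (y≢j ∘ toℕ-injective ∘ sym) ⟩
        toℕ y                     ≤⟨ transpose-adjacent-≥ y≢j ⟩
        toℕ (PC.transpose j i y)  ∎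
      by-cases (no x≢i) (yes refl) = begin-strict
        toℕ (PC.transpose j i x)  ≤⟨ transpose-adjacent-≤ x≢i ⟩
        toℕ x                     <⟨ ≤∧≢⇒< (s≤s⁻¹ (subst (toℕ x <_) adjacent x<y)) (x≢i ∘ toℕ-injective) ⟩
        toℕ i                     ≡⟨ cong toℕ (transpose-matchˡ j i) ⟨
        toℕ (PC.transpose j i j)  ∎
      by-cases (no x≢i) (no y≢j) = begin-strict
        toℕ (PC.transpose j i x)  ≤⟨ transpose-adjacent-≤ x≢i ⟩
        toℕ x                     <⟨ x<y ⟩
        toℕ y                     ≤⟨ transpose-adjacent-≥ y≢j ⟩
        toℕ (PC.transpose j i y)  ∎

  move⇒sameLocalOrder : {k : ℕ} {σ τ : Permutation′ n} → Move k σ τ → SameLocalOrder k σ τ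
  move⇒sameLocalOrder {k} {σ} {τ} (i , j , adjacent , far , τ≗σ∘tr) u w (close uw) σuw =
    subst₂ _<_ (cong toℕ (τ⁻¹ u)) (cong toℕ (τ⁻¹ w)) (transpose-adjacent-< adjacent σuw not-ij)
    where
    τ⁻¹ : ∀ v → PC.transpose j i (σ ⟨$⟩ˡ v) ≡ τ ⟨$⟩ˡ v
    τ⁻¹ v = begin
      PC.transpose j i (σ ⟨$⟩ˡ v)                ≡⟨ inverseˡ τ ⟨
      τ ⟨$⟩ˡ (τ ⟨$⟩ʳ PC.transpose j i (σ ⟨$⟩ˡ v))  ≡⟨ cong (τ ⟨$⟩ˡ_) (τ≗σ∘tr _) ⟩
      τ ⟨$⟩ˡ (σ ⟨$⟩ʳ (PC.transpose i j (PC.transpose j i (σ ⟨$⟩ˡ v))))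
                                                  ≡⟨ cong (λ x → τ ⟨$⟩ˡ (σ ⟨$⟩ʳ x)) (PC.transpose-inverse i j) ⟩
      τ ⟨$⟩ˡ (σ ⟨$⟩ʳ (σ ⟨$⟩ˡ v))                 ≡⟨ cong (τ ⟨$⟩ˡ_) (inverseʳ σ) ⟩
      τ ⟨$⟩ˡ v                                    ∎
      where open ≡-Reasoning
    not-ij : ¬ (σ ⟨$⟩ˡ u ≡ i × σ ⟨$⟩ˡ w ≡ j)
    not-ij (refl , refl) = <⇒≱ uw (subst₂ (λ a b → k ≤ ∣ toℕ a - toℕ b ∣) (inverseʳ σ) (inverseʳ σ) far)

  star⇒sameLocalOrder : {k : ℕ} {σ τ : Permutation′ n} → Star (Move k) σ τ → SameLocalOrder k σ τ
  star⇒sameLocalOrder ε _ _ _ = id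
  star⇒sameLocalOrder {k} {σ} {τ} (_◅_ {j = ρ} move moves) =
    agreesOn-trans {R = Close k} {σ} {ρ} {τ} (move⇒sameLocalOrder {σ = σ} {ρ} move) (star⇒sameLocalOrder moves)

  reachable⇒sameLocalOrder : {k : ℕ} {σ τ : Permutation′ n} → Reachable k σ τ → SameLocalOrder k σ τ
  reachable⇒sameLocalOrder {k} {σ} {τ} (ρ , moves , ρ≈τ) =
    agreesOn-trans {σ = σ} {ρ} {τ} (star⇒sameLocalOrder moves) (≈⇒agreesOn {R = Close k} {ρ} {τ} ρ≈τ)

  -- The predicate counted by entry v of RC k σ = DC k (flip σ), where letters are numbered from 1.
  RecoilTest : Permutation′ n → Fin n → ℕ → Set
  RecoilTest σ v t = ext (flip σ) (+ suc (toℕ v) - + t) ℤ.< ext (flip σ) (+ suc (toℕ v))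

  recoilTest? : (σ : Permutation′ n) (v : Fin n) → Decidable (RecoilTest σ v)
  recoilTest? σ v t = ext (flip σ) (+ suc (toℕ v) - + t) ℤ.<? ext (flip σ) (+ suc (toℕ v))

  recoilCount : ℕ → Permutation′ n → Fin n → ℕ
  recoilCount k σ v = length (filter (recoilTest? σ v) (offsets k))

  SameRecoilCounts : ℕ → Permutation′ n → Permutation′ n → Set
  SameRecoilCounts k σ τ = ∀ v → recoilCount k σ v ≡ recoilCount k τ v

  lookup-RC : (k : ℕ) (σ : Permutation′ n) (v : Fin n) → lookup (RC k σ) v ≡ suc (recoilCount k σ v)
  lookup-RC k σ v = lookup∘tabulate _ v

  recoilTest-below : (σ : Permutation′ n) {u v : Fin n} {t : ℕ} → toℕ u + t ≡ toℕ v →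
                     RecoilTest σ v t ⇔ Before σ u v
  recoilTest-below σ {u} {v} {t} u+t≡v =
    mk⇔ (λ r → s<s⁻¹ (ℤ.drop‿+<+ (subst₂ ℤ._<_ lhs rhs r)))
        (λ σuv → subst₂ ℤ._<_ (sym lhs) (sym rhs) (+<+ (s<s σuv)))
    where
    open ≡-Reasoning
    lhs : ext (flip σ) (+ suc (toℕ v) - + t) ≡ + suc (pos σ u)
    lhs = begin
      ext (flip σ) (+ suc (toℕ v) - + t)          ≡⟨ cong (λ m → ext (flip σ) (+ suc m - + t)) u+t≡v ⟨
      ext (flip σ) (+ suc (toℕ u + t) - + t)      ≡⟨ cong (ext (flip σ)) (+suc[m+n]-+n (toℕ u) t) ⟩
      ext (flip σ) (+ suc (toℕ u))                ≡⟨ ext-fin (flip σ) u ⟩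
      + suc (pos σ u)                             ∎
    rhs : ext (flip σ) (+ suc (toℕ v)) ≡ + suc (pos σ v)
    rhs = ext-fin (flip σ) v

  recoilTest-above : (σ : Permutation′ n) {v : Fin n} {t : ℕ} → toℕ v < t → RecoilTest σ v t
  recoilTest-above σ {v} {t} v<t =
    subst₂ ℤ._<_ (sym (ext-nonpositive (flip σ) x≤0)) (sym (ext-fin (flip σ) v)) (ℤ.≤-<-trans x≤0 (+<+ z<s))
    where
    x≤0 : + suc (toℕ v) - + t ℤ.≤ + 0
    x≤0 = ℤ.i≤j⇒i-j≤0 (+≤+ v<t)

  offsetBelow : (v : Fin n) {t : ℕ} → t ≤ toℕ v → ∃ λ u → toℕ u + t ≡ toℕ v
  offsetBelow v {t} t≤v =
    fromℕ< (≤-<-trans (m∸n≤m (toℕ v) t) (toℕ<n v)) , trans (cong (_+ t) (toℕ-fromℕ< _)) (m∸n+n≡m t≤v)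

  close-offset : {k t : ℕ} {u v : Fin n} → toℕ u + t ≡ toℕ v → t < k → Close k u v
  close-offset {k} {t} {u} u+t≡v = close ∘
    subst (_< k) (sym (trans (cong (λ m → ∣ toℕ u - m ∣) (sym u+t≡v)) (∣m-m+n∣≡n (toℕ u) t)))

  close-below : {k : ℕ} {c u w : Fin n} → toℕ c ≤ toℕ w → toℕ u ≤ toℕ w →
                Close k c w → Close k u w → Close k c u
  close-below {k} {c} {u} {w} c≤w u≤w (close cw) (close uw) with ≤-total (toℕ c) (toℕ u)
  ... | inj₁ c≤u = close (≤-<-trans (∣m-n∣≤∣m-o∣ c≤u u≤w) cw)
  ... | inj₂ u≤c =
    close (subst (_< k) (∣-∣-comm (toℕ u) (toℕ c)) (≤-<-trans (∣m-n∣≤∣m-o∣ u≤c c≤w) uw))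

  sameLocalOrder⇒recoilTest : {k : ℕ} {σ τ : Permutation′ n} → SameLocalOrder k σ τ →
                              (v : Fin n) → All (λ t → RecoilTest σ v t → RecoilTest τ v t) (offsets k)
  sameLocalOrder⇒recoilTest {k} {σ} {τ} same v = All.tabulate transfer
    where
    transfer : ∀ {t} → t ∈ offsets k → RecoilTest σ v t → RecoilTest τ v t
    transfer {t} t∈ r with t ≤? toℕ v
    ... | no t≰v = recoilTest-above τ (≰⇒> t≰v)
    ... | yes t≤v with u , u+t≡v ← offsetBelow v t≤v =
      Equivalence.from (recoilTest-below τ u+t≡v)
        (same u v (close-offset u+t≡v (proj₂ (∈-offsets⁻ {k} t∈))) (Equivalence.to (recoilTest-below σ u+t≡v) r))

  sameLocalOrder⇒recoilCount≡ : {k : ℕ} {σ τ : Permutation′ n} → SameLocalOrder k σ τ →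
                                SameRecoilCounts k σ τ
  sameLocalOrder⇒recoilCount≡ {k} {σ} {τ} same v = ≤-antisym
    (length-filter-mono (recoilTest? σ v) (recoilTest? τ v) (sameLocalOrder⇒recoilTest same v))
    (length-filter-mono (recoilTest? τ v) (recoilTest? σ v)
      (sameLocalOrder⇒recoilTest (agreesOn-sym close-sym {σ} {τ} same) v))

  CloseBelow : ℕ → ℕ → Fin n → Fin n → Set
  CloseBelow k m u w = toℕ u < m × toℕ w < m × Close k u w

  closeBelow-sym : {k m : ℕ} → Symmetric (CloseBelow k m)
  closeBelow-sym (u<m , w<m , uw) = w<m , u<m , close-sym uw

  -- Every offset counted at w for τ is counted for σ too, and w - u only for σ.
  closePair-notInverted : {k : ℕ} {σ τ : Permutation′ n} {u w : Fin n} →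
    recoilCount k σ w ≡ recoilCount k τ w → OrderAgreesOn (CloseBelow k (toℕ w)) τ σ →
    toℕ u < toℕ w → Close k u w → Before σ u w → ¬ Before τ w u
  closePair-notInverted {k} {σ} {τ} {u} {w} counts≡ agreeBelow u<w uw σuw τwu =
    <-irrefl (sym counts≡)
      (length-filter-mono-< (recoilTest? τ w) (recoilTest? σ w) (All.tabulate τ⇒σ) (lose t₀∈ (σ-t₀ , ¬τ-t₀)))
    where
    t₀ : ℕ
    t₀ = toℕ w ∸ toℕ u
    u+t₀≡w : toℕ u + t₀ ≡ toℕ w
    u+t₀≡w = m+[n∸m]≡n (<⇒≤ u<w)
    t₀∈ : t₀ ∈ offsets k
    t₀∈ = ∈-offsets⁺ (m<n⇒0<n∸m u<w) (subst (_< k) (m≤n⇒∣m-n∣≡n∸m (<⇒≤ u<w)) (Close.distance< uw))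
    σ-t₀ : RecoilTest σ w t₀
    σ-t₀ = Equivalence.from (recoilTest-below σ u+t₀≡w) σuw
    ¬τ-t₀ : ¬ RecoilTest τ w t₀
    ¬τ-t₀ = <-asym τwu ∘ Equivalence.to (recoilTest-below τ u+t₀≡w)
    τ⇒σ : ∀ {t} → t ∈ offsets k → RecoilTest τ w t → RecoilTest σ w t
    τ⇒σ {t} t∈ r with t ≤? toℕ w
    ... | no t≰w = recoilTest-above σ (≰⇒> t≰w)
    ... | yes t≤w with c , c+t≡w ← offsetBelow w t≤w = Equivalence.from (recoilTest-below σ c+t≡w) σcw
      where
      c<w : toℕ c < toℕ w
      c<w = subst (toℕ c <_) c+t≡w (m<m+n (toℕ c) (proj₁ (∈-offsets⁻ {k} t∈)))
      cu : Close k c u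
      cu = close-below (<⇒≤ c<w) (<⇒≤ u<w) (close-offset c+t≡w (proj₂ (∈-offsets⁻ {k} t∈))) uw
      τcu : Before τ c u
      τcu = <-trans (Equivalence.to (recoilTest-below τ c+t≡w) r) τwu
      σcw : Before σ c w
      σcw = <-trans (agreeBelow c u (c<w , u<w , cu) τcu) σuw

  agreesBelow-suc : {k m : ℕ} {σ τ : Permutation′ n} → SameRecoilCounts k σ τ →
    OrderAgreesOn (CloseBelow k m) σ τ → OrderAgreesOn (CloseBelow k (suc m)) σ τ
  agreesBelow-suc {k} {m} {σ} {τ} counts≡ agreeBelow u w (u<1+m , w<1+m , uw) σuw
    with m<1+n⇒m<n∨m≡n u<1+m | m<1+n⇒m<n∨m≡n w<1+m
  ... | inj₁ u<m | inj₁ w<m = agreeBelow u w (u<m , w<m , uw) σuw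
  ... | inj₁ u<w | inj₂ refl = reflects⇒preserves {σ = σ} {τ = τ}
          (⊥-elim ∘ closePair-notInverted (counts≡ w) agreeBelowᵒ u<w uw σuw) σuw
    where
    agreeBelowᵒ : OrderAgreesOn (CloseBelow k (toℕ w)) τ σ
    agreeBelowᵒ = agreesOn-sym closeBelow-sym {σ} {τ} agreeBelow
  ... | inj₂ refl | inj₁ w<u = reflects⇒preserves {σ = σ} {τ = τ}
          (contradiction σuw ∘ closePair-notInverted (sym (counts≡ u)) agreeBelow w<u (close-sym uw)) σuw
  ... | inj₂ u≡m | inj₂ w≡m = contradiction σuw (<-irrefl (cong (pos σ) (toℕ-injective (trans u≡m (sym w≡m)))))

  recoilCount≡⇒sameLocalOrder : {k : ℕ} {σ τ : Permutation′ n} → SameRecoilCounts k σ τ → SameLocalOrder k σ τ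
  recoilCount≡⇒sameLocalOrder {k} {σ} {τ} counts≡ u w uw = agreesBelow n u w (toℕ<n u , toℕ<n w , uw)
    where
    agreesBelow : ∀ m → OrderAgreesOn (CloseBelow k m) σ τ
    agreesBelow zero _ _ (() , _)
    agreesBelow (suc m) = agreesBelow-suc counts≡ (agreesBelow m)

  RC≡⇒recoilCount≡ : {k : ℕ} {σ τ : Permutation′ n} → RC k σ ≡ RC k τ → SameRecoilCounts k σ τ
  RC≡⇒recoilCount≡ {k} {σ} {τ} RC≡ v = suc-injective (begin
    suc (recoilCount k σ v)  ≡⟨ lookup-RC k σ v ⟨
    lookup (RC k σ) v        ≡⟨ cong (λ code → lookup code v) RC≡ ⟩
    lookup (RC k τ) v        ≡⟨ lookup-RC k τ v ⟩
    suc (recoilCount k τ v)  ∎)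
    where open ≡-Reasoning

  recoilCount≡⇒RC≡ : {k : ℕ} {σ τ : Permutation′ n} → SameRecoilCounts k σ τ → RC k σ ≡ RC k τ
  recoilCount≡⇒RC≡ counts≡ = tabulate-cong (cong suc ∘ counts≡)

  Reaches : ℕ → (Permutation′ n → Set) → Permutation′ n → Set
  Reaches k P σ = ∃ λ ρ → Star (Move k) σ ρ × P ρ

  reaches-bind : {k : ℕ} {P Q : Permutation′ n → Set} {σ : Permutation′ n} →
                 Reaches k P σ → (∀ {ρ} → P ρ → Reaches k Q ρ) → Reaches k Q σ
  reaches-bind (ρ , moves , pρ) continue with continue pρ
  ... | ρ′ , moves′ , qρ′ = ρ′ , moves ◅◅ moves′ , qρ′

  AgreeBelow : ℕ → Permutation′ n → Permutation′ n → Set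
  AgreeBelow m σ τ = ∀ x → toℕ x < m → σ ⟨$⟩ʳ x ≡ τ ⟨$⟩ʳ x

  agreeBelow-sym : {m : ℕ} {σ τ : Permutation′ n} → AgreeBelow m σ τ → AgreeBelow m τ σ
  agreeBelow-sym agree x x<m = sym (agree x x<m)

  agreeBelow-position : {m : ℕ} {σ τ : Permutation′ n} → AgreeBelow m σ τ →
                        (i : Fin n) → pos σ (τ ⟨$⟩ʳ i) < m → toℕ i < m
  agreeBelow-position {m} {σ} {τ} agree i x<m = subst (λ y → toℕ y < m) x≡i x<m
    where
    x : Fin n
    x = σ ⟨$⟩ˡ (τ ⟨$⟩ʳ i)
    x≡i : x ≡ i
    x≡i = ⟨$⟩ʳ-injective τ (trans (sym (agree x x<m)) (inverseʳ σ))

  agreeBelow-suc : {m : ℕ} {σ τ : Permutation′ n} → AgreeBelow m σ τ →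
                   (j : Fin n) → toℕ j ≡ m → σ ⟨$⟩ʳ j ≡ τ ⟨$⟩ʳ j → AgreeBelow (suc m) σ τ
  agreeBelow-suc {σ = σ} {τ} agree j j≡m σj≡τj x x<1+m with m<1+n⇒m<n∨m≡n x<1+m
  ... | inj₁ x<m = agree x x<m
  ... | inj₂ x≡m = subst (λ y → σ ⟨$⟩ʳ y ≡ τ ⟨$⟩ʳ y) (toℕ-injective (trans j≡m (sym x≡m))) σj≡τj

  module Sorting (k : ℕ) (τ : Permutation′ n) where

    SortedUpTo : ℕ → Permutation′ n → Set
    SortedUpTo m σ = SameLocalOrder k σ τ × AgreeBelow m σ τ

    adjacent-far : {m : ℕ} {σ : Permutation′ n} → SortedUpTo m σ → {i p : Fin n} →
                   toℕ p ≡ suc (toℕ i) → m ≤ toℕ i → pos τ (σ ⟨$⟩ʳ p) ≡ m →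
                   k ≤ ∣ toℕ (σ ⟨$⟩ʳ i) - toℕ (σ ⟨$⟩ʳ p) ∣
    adjacent-far {m} {σ} (same , agree) {i} {p} adjacent m≤i τp≡m =
      ≮⇒≥ λ near →
        <⇒≱ (agreeBelow-position {σ = τ} {σ} (agreeBelow-sym {σ = σ} {τ} agree) i (τi<m near)) m≤i
      where
      σip : Before σ (σ ⟨$⟩ʳ i) (σ ⟨$⟩ʳ p)
      σip = subst₂ _<_ (sym (cong toℕ (inverseˡ σ))) (sym (cong toℕ (inverseˡ σ)))
              (subst (toℕ i <_) (sym adjacent) (n<1+n (toℕ i)))
      τi<m : ∣ toℕ (σ ⟨$⟩ʳ i) - toℕ (σ ⟨$⟩ʳ p) ∣ < k → pos τ (σ ⟨$⟩ʳ i) < m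
      τi<m near = subst (pos τ (σ ⟨$⟩ʳ i) <_) τp≡m (same _ _ (close near) σip)

    bubble : {m : ℕ} {σ : Permutation′ n} → SortedUpTo m σ → (j : Fin n) → toℕ j ≡ m →
             (p : Fin n) → σ ⟨$⟩ʳ p ≡ τ ⟨$⟩ʳ j → ∀ d → toℕ p ≡ m + d →
             Reaches k (SortedUpTo (suc m)) σ
    bubble {m} {σ} (same , agree) j j≡m p σp≡τj zero p≡m+0 =
      σ , ε , same , agreeBelow-suc {σ = σ} {τ} agree j j≡m (subst (λ y → σ ⟨$⟩ʳ y ≡ τ ⟨$⟩ʳ j) p≡j σp≡τj)
      where
      p≡j : p ≡ j
      p≡j = toℕ-injective (trans p≡m+0 (trans (+-identityʳ m) (sym j≡m)))
    bubble {m} {σ} sorted@(same , agree) j j≡m p σp≡τj (suc d) p≡m+1+d =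
      let ρ , moves , sortedρ = bubble {σ = σ₁} (same₁ , agree₁) j j≡m i σ₁i≡τj d i≡m+d
      in  ρ , move ◅ moves , sortedρ
      where
      m+d<n : m + d < n
      m+d<n = <-trans (n<1+n (m + d)) (subst (_< n) (trans p≡m+1+d (+-suc m d)) (toℕ<n p))
      i : Fin n
      i = fromℕ< m+d<n
      i≡m+d : toℕ i ≡ m + d
      i≡m+d = toℕ-fromℕ< m+d<n
      adjacent : toℕ p ≡ suc (toℕ i)
      adjacent = trans p≡m+1+d (trans (+-suc m d) (cong suc (sym i≡m+d)))
      m≤i : m ≤ toℕ i
      m≤i = subst (m ≤_) (sym i≡m+d) (m≤m+n m d)
      τp≡m : pos τ (σ ⟨$⟩ʳ p) ≡ m
      τp≡m = trans (cong (pos τ) σp≡τj) (trans (cong toℕ (inverseˡ τ)) j≡m)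
      σ₁ : Permutation′ n
      σ₁ = transpose i p ∘ₚ σ
      move : Move k σ σ₁
      move = i , p , adjacent , adjacent-far {σ = σ} sorted adjacent m≤i τp≡m , λ _ → refl
      σ₁i≡τj : σ₁ ⟨$⟩ʳ i ≡ τ ⟨$⟩ʳ j
      σ₁i≡τj = trans (cong (σ ⟨$⟩ʳ_) (transpose-matchˡ i p)) σp≡τj
      m≤p : m ≤ toℕ p
      m≤p = subst (m ≤_) (sym adjacent) (≤-trans m≤i (n≤1+n (toℕ i)))
      agree₁ : AgreeBelow m σ₁ τ
      agree₁ x x<m = trans (cong (σ ⟨$⟩ʳ_) (transpose-mismatch (beyond m≤i) (beyond m≤p))) (agree x x<m)
        where
        beyond : {y : Fin n} → m ≤ toℕ y → x ≢ y
        beyond m≤y = <⇒≢ (<-≤-trans x<m m≤y) ∘ cong toℕ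
      same₁ : SameLocalOrder k σ₁ τ
      same₁ = agreesOn-trans {σ = σ₁} {σ} {τ}
                (agreesOn-sym close-sym {σ} {σ₁} (move⇒sameLocalOrder {σ = σ} {σ₁} move)) same

    placeNext : {m : ℕ} {σ : Permutation′ n} → SortedUpTo m σ → m < n → Reaches k (SortedUpTo (suc m)) σ
    placeNext {m} {σ} sorted@(_ , agree) m<n =
      bubble {σ = σ} sorted j j≡m p (inverseʳ σ) (toℕ p ∸ m) (sym (m+[n∸m]≡n m≤p))
      where
      j : Fin n
      j = fromℕ< m<n
      j≡m : toℕ j ≡ m
      j≡m = toℕ-fromℕ< m<n
      p : Fin n
      p = σ ⟨$⟩ˡ (τ ⟨$⟩ʳ j)
      m≤p : m ≤ toℕ p
      m≤p = ≮⇒≥ (<-irrefl j≡m ∘ agreeBelow-position {σ = σ} {τ} agree j)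

    sortUpTo : {σ : Permutation′ n} → SameLocalOrder k σ τ → ∀ m → m ≤ n → Reaches k (SortedUpTo m) σ
    sortUpTo {σ} same zero _ = σ , ε , same , λ _ ()
    sortUpTo {σ} same (suc m) m<n =
      reaches-bind {σ = σ} (sortUpTo same m (<⇒≤ m<n)) (λ {ρ} sorted → placeNext {σ = ρ} sorted m<n)

  sameLocalOrder⇒reachable : {k : ℕ} {σ τ : Permutation′ n} → SameLocalOrder k σ τ → Reachable k σ τ
  sameLocalOrder⇒reachable {k} {σ} {τ} same with Sorting.sortUpTo k τ same n ≤-refl
  ... | ρ , moves , _ , agree = ρ , moves , λ x → agree x (toℕ<n x)

mainTheorem2 : (k : ℕ) → 1 ≤ k → (n : ℕ) → (σ τ : Permutation′ n) →
    (RC k σ ≡ RC k τ → Reachable k σ τ) × (Reachable k σ τ → RC k σ ≡ RC k τ)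
mainTheorem2 k _ n σ τ = RC⇒reachable , reachable⇒RC
  where
  RC⇒reachable : RC k σ ≡ RC k τ → Reachable k σ τ
  RC⇒reachable =
    sameLocalOrder⇒reachable {k = k} {σ} {τ} ∘ recoilCount≡⇒sameLocalOrder ∘ RC≡⇒recoilCount≡ {k = k} {σ} {τ}

  reachable⇒RC : Reachable k σ τ → RC k σ ≡ RC k τ
  reachable⇒RC =
    recoilCount≡⇒RC≡ {k = k} {σ} {τ} ∘ sameLocalOrder⇒recoilCount≡ ∘ reachable⇒sameLocalOrder {k = k} {σ} {τ}
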